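{- Let $T$ be a tree, let $p\ge 3$ be an integer, and let $\ell=|V(T^{p+1})|$. Then $T^{p+1}\subseteq P_\ell\vee K((p-1)\ell;p-1)$ and $T^{p+1}\subseteq \ell P_2\vee K(2(p-1)\ell;p-1)$.
   Context: For a graph $F$ and integer $p\ge1$, the edge blow-up $F^{p+1}$ is the graph obtained from $F$ by replacing each edge $uv$ by a clique $K_{p+1}$ containing $u,v$, where the new vertices added for different edges are all distinct. $P_\ell$ is the path on $\ell$ vertices, $\ell P_2$ is a matching of $\ell$ edges, $\vee$ denotes the join of two vertex-disjoint graphs, and $K(n;q)$ denotes the complete $q$-partite graph on $n$ vertices with class sizes differing by at most one. $H\subseteq G$ means $G$ contains a subgraph isomorphic to $H$. -}

module Defs where

open import Level using (0ℓ)
open import Data.Nat using (ℕ; zero; suc; _+_; _*_; _∸_; _%_)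
open import Data.Fin using (Fin; toℕ; inject₁; fromℕ; _<_) renaming (zero to fzero; suc to fsuc)
open import Data.Bool using (Bool; true; false; _∧_; if_then_else_)
open import Data.Product using (Σ; _×_; _,_; proj₁; proj₂; ∃)
open import Data.Sum using (_⊎_; inj₁; inj₂)
open import Data.Unit using (⊤)
open import Data.Empty using (⊥)
open import Relation.Binary.PropositionalEquality using (_≡_; _≢_)
open import Relation.Nullary.Decidable using (⌊_⌋)
open import Function.Definitions using (Injective)
import Data.Fin.Properties as FinP

record Graph : Set₁ where
  field
    V   : Set
    Adj : V → V → Set
open Graph public

_⊆G_ : Graph → Graph → Set
H ⊆G G = Σ (V H → V G) λ f →
  Injective _≡_ _≡_ f × (∀ u v → Adj H u v → Adj G (f u) (f v))

_∨G_ : Graph → Graph → Graph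
G ∨G H = record { V = V G ⊎ V H ; Adj = adj }
  where
  adj : V G ⊎ V H → V G ⊎ V H → Set
  adj (inj₁ a) (inj₁ b) = Adj G a b
  adj (inj₂ a) (inj₂ b) = Adj H a b
  adj (inj₁ _) (inj₂ _) = ⊤
  adj (inj₂ _) (inj₁ _) = ⊤

PathG : ℕ → Graph
PathG ℓ = record { V = Fin ℓ
                 ; Adj = λ i j → (toℕ j ≡ suc (toℕ i)) ⊎ (toℕ i ≡ suc (toℕ j)) }

MatchingG : ℕ → Graph
MatchingG ℓ = record { V = Fin ℓ × Fin 2
                     ; Adj = λ x y → (proj₁ x ≡ proj₁ y) × (proj₂ x ≢ proj₂ y) }

-- K(N;q): complete q-partite graph on N vertices; vertex i lies in class
-- (i mod q), so class sizes differ by at most one.  (Only used for q ≥ 1.)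
classOf : ℕ → ℕ → ℕ
classOf zero    i = 0
classOf (suc q) i = i % suc q

TuranG : ℕ → ℕ → Graph
TuranG N q = record { V = Fin N
                    ; Adj = λ i j → classOf q (toℕ i) ≢ classOf q (toℕ j) }

record SGraph (n : ℕ) : Set where
  field
    adj    : Fin n → Fin n → Bool
    sym    : ∀ i j → adj i j ≡ adj j i
    irrefl : ∀ i → adj i i ≡ false
open SGraph public

data Walk {n} (T : SGraph n) : Fin n → Fin n → Set where
  nil  : ∀ {u} → Walk T u u
  cons : ∀ {u v w} → adj T u v ≡ true → Walk T v w → Walk T u w

Connected : ∀ {n} → SGraph n → Set
Connected T = ∀ u v → Walk T u v

HasCycle : ∀ {n} → SGraph n → Set
HasCycle {n} T = Σ ℕ λ k → Σ (Fin (3 + k) → Fin n) λ c →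
  Injective _≡_ _≡_ c ×
  (∀ (i : Fin (2 + k)) → adj T (c (inject₁ i)) (c (fsuc i)) ≡ true) ×
  (adj T (c (fromℕ (2 + k))) (c fzero) ≡ true)

IsTree : ∀ {n} → SGraph n → Set
IsTree T = Connected T × (HasCycle T → ⊥)

Edge : ∀ {n} → SGraph n → Set
Edge {n} T = Σ (Fin n × Fin n) λ e → (proj₁ e < proj₂ e) × (adj T (proj₁ e) (proj₂ e) ≡ true)

-- F^{p+1}: vertices of F plus p-1 new vertices for each edge; each edge uv
-- together with its p-1 new vertices forms a clique K_{p+1}.
blowup : ∀ {n} → SGraph n → ℕ → Graph
blowup {n} T p = record { V = Fin n ⊎ (Edge T × Fin (p ∸ 1)) ; Adj = A }
  where
  A : Fin n ⊎ (Edge T × Fin (p ∸ 1)) → Fin n ⊎ (Edge T × Fin (p ∸ 1)) → Set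
  A (inj₁ u) (inj₁ v) = adj T u v ≡ true
  A (inj₁ u) (inj₂ (e , _)) = (u ≡ proj₁ (proj₁ e)) ⊎ (u ≡ proj₂ (proj₁ e))
  A (inj₂ (e , _)) (inj₁ u) = (u ≡ proj₁ (proj₁ e)) ⊎ (u ≡ proj₂ (proj₁ e))
  A (inj₂ (e , a)) (inj₂ (e' , b)) = (proj₁ e ≡ proj₁ e') × (a ≢ b)

sumFin : ∀ m → (Fin m → ℕ) → ℕ
sumFin zero    f = 0
sumFin (suc m) f = f fzero + sumFin m (λ i → f (fsuc i))

edgeCount : ∀ {n} → SGraph n → ℕ
edgeCount {n} T = sumFin n λ i → sumFin n λ j →
  if ⌊ i FinP.<? j ⌋ ∧ adj T i j then 1 else 0

blowupSize : ∀ {n} → SGraph n → ℕ → ℕ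
blowupSize {n} T p = n + (p ∸ 1) * edgeCount T

-- A tree T is bipartite: colour each vertex by the parity of the length of a walk
-- from it to a fixed root.  An edge joining two vertices of the same colour would close
-- an odd closed walk, and an odd closed walk contains a cycle, because a shortest one
-- has no repeated vertex (cutting it at a repetition leaves two shorter closed walks,
-- one of which is odd).
--
-- Given the bipartition, T^{p+1} embeds into G ∨ K(N; p-1) whenever G contains a
-- matching with one edge per edge of T and N ≥ (|V(T)| + |E(T)|)(p-1).  Reserve in
-- K(N; p-1) one slot of p-1 vertices, one per class, for every vertex and every edge
-- of T.  A vertex of T goes to class 0 or 1 of its slot according to its colour; of the
-- p-1 new vertices of an edge e, two go to the ends of the matching edge of e in G and
-- the other p-3 to classes 2, …, p-2 of the slot of e.  Both P_ℓ and ℓP_2 contain such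
-- a matching, and ℓ = |V(T)| + (p-1)|E(T)| leaves enough room in both hosts.

module Submission where

open import Axiom.UniquenessOfIdentityProofs using (module Decidable⇒UIP)
open import Data.Bool as Bool using (Bool; true; _∧_; if_then_else_)
open import Data.Empty using (⊥-elim)
open import Data.Fin as F using (Fin; toℕ; inject₁; inject≤; combine; fromℕ; _↑ˡ_; _↑ʳ_; splitAt)
  renaming (zero to fzero; suc to fsuc)
import Data.Fin.Properties as Finₚ
open import Data.Fin.Properties
  using (any?; toℕ-injective; toℕ-inject≤; toℕ-combine; combine-injective; inject≤-injective;
         splitAt-↑ˡ; splitAt-↑ʳ; ↑ˡ-injective; ↑ʳ-injective; toℕ<n; toℕ-inject₁; toℕ-fromℕ)
open import Data.Nat using (ℕ; zero; suc; _+_; _*_; _∸_; _%_; _≤_; _<_; _≤?_; z≤n; s≤s; s≤s⁻¹; parity)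
open import Data.Nat.Divisibility using (m∣m*n)
open import Data.Nat.DivMod using (%-remove-+ˡ; m<n⇒m%n≡m)
open import Data.Nat.Induction using (<-rec)
open import Data.Nat.Properties
open import Data.Parity using (Parity; 0ℙ; 1ℙ) renaming (_+_ to _+ℙ_)
open import Data.Parity.Properties using (+-homo-+; p+p≡0ℙ)
open import Data.Product using (Σ; ∃₂; _×_; _,_; proj₁; proj₂; uncurry)
open import Data.Product.Properties using (Σ-≡,≡←≡)
open import Data.Sum using (_⊎_; inj₁; inj₂; [_,_]′)
open import Data.Sum.Properties using (inj₁-injective; inj₂-injective)
open import Data.Unit using (tt)
open import Defs hiding (sym)
open import Function using (_∘_)
open import Function.Definitions using (Injective)
open import Relation.Binary.Definitions using (tri<; tri≈; tri>)
open import Relation.Binary.PropositionalEquality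
open import Relation.Nullary using (Dec; ¬_; yes; no; _×-dec_)
open import Relation.Nullary.Decidable using (⌊_⌋)

module _ {n : ℕ} {T : SGraph n} where

  length : ∀ {u v} → Walk T u v → ℕ
  length nil        = 0
  length (cons _ w) = suc (length w)

  _++_ : ∀ {u v w} → Walk T u v → Walk T v w → Walk T u w
  nil      ++ w′ = w′
  cons a w ++ w′ = cons a (w ++ w′)

  length-++ : ∀ {u v w} (w₁ : Walk T u v) (w₂ : Walk T v w) → length (w₁ ++ w₂) ≡ length w₁ + length w₂
  length-++ nil        w₂ = refl
  length-++ (cons _ w) w₂ = cong suc (length-++ w w₂)

  reverse : ∀ {u v} → Walk T u v → Walk T v u
  reverse nil                          = nil
  reverse (cons {u = u} {v = v} a w) = reverse w ++ cons (trans (SGraph.sym T v u) a) nil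

  length-reverse : ∀ {u v} (w : Walk T u v) → length (reverse w) ≡ length w
  length-reverse nil        = refl
  length-reverse (cons a w) = begin
    length (reverse w ++ cons _ nil) ≡⟨ length-++ (reverse w) (cons _ nil) ⟩
    length (reverse w) + 1           ≡⟨ cong (_+ 1) (length-reverse w) ⟩
    length w + 1                     ≡⟨ +-comm (length w) 1 ⟩
    suc (length w)                   ∎
    where open ≡-Reasoning

  position : ∀ {u v} → Walk T u v → ℕ → Fin n
  position {u} nil        _       = u
  position {u} (cons _ w) zero    = u
  position     (cons _ w) (suc k) = position w k

  position-start : ∀ {u v} (w : Walk T u v) → position w 0 ≡ u
  position-start nil        = refl
  position-start (cons _ w) = refl

  position-end : ∀ {u v} (w : Walk T u v) → position w (length w) ≡ v
  position-end nil        = refl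
  position-end (cons _ w) = position-end w

  position-step : ∀ {u v} (w : Walk T u v) i → i < length w → adj T (position w i) (position w (suc i)) ≡ true
  position-step (cons a w) zero    _         rewrite position-start w = a
  position-step (cons _ w) (suc i) (s≤s i<ℓ) = position-step w i i<ℓ

odd-+⇒odd⊎odd : ∀ a b → parity (a + b) ≡ 1ℙ → parity a ≡ 1ℙ ⊎ parity b ≡ 1ℙ
odd-+⇒odd⊎odd a b odd rewrite +-homo-+ a b with parity a
... | 1ℙ = inj₁ refl
... | 0ℙ = inj₂ odd

module _ {n : ℕ} (T : SGraph n) where

  record ClosedWalk (L : ℕ) : Set where
    field
      vertex : ℕ → Fin n
      step   : ∀ i → i < L → adj T (vertex i) (vertex (suc i)) ≡ true
      closed : vertex L ≡ vertex 0
  open ClosedWalk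

  closedWalk : ∀ {u} (w : Walk T u u) → ClosedWalk (length w)
  closedWalk w = record
    { vertex = position w
    ; step   = position-step w
    ; closed = trans (position-end w) (sym (position-start w))
    }

  Repeats : ∀ L → (ℕ → Fin n) → Set
  Repeats L f = ∃₂ λ (i j : Fin L) → i F.< j × f (toℕ i) ≡ f (toℕ j)

  repeats? : ∀ L f → Dec (Repeats L f)
  repeats? L f = any? λ i → any? λ j → (i F.<? j) ×-dec (f (toℕ i) F.≟ f (toℕ j))

  ¬Repeats⇒injective : ∀ {L f} → ¬ Repeats L f → ∀ {i j : Fin L} → f (toℕ i) ≡ f (toℕ j) → i ≡ j
  ¬Repeats⇒injective ¬rep {i} {j} same with Finₚ.<-cmp i j
  ... | tri< i<j _ _ = ⊥-elim (¬rep (i , j , i<j , same))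
  ... | tri≈ _ i≡j _ = i≡j
  ... | tri> _ _ j<i = ⊥-elim (¬rep (j , i , j<i , sym same))

  simpleOddClosedWalk⇒cycle : ∀ {L} → parity L ≡ 1ℙ → (w : ClosedWalk L) → ¬ Repeats L (vertex w) → HasCycle T
  simpleOddClosedWalk⇒cycle {1} _ w _ with trans (sym (irrefl T (vertex w 0))) loop
    where
    loop : adj T (vertex w 0) (vertex w 0) ≡ true
    loop = subst (λ v → adj T (vertex w 0) v ≡ true) (closed w) (step w 0 (s≤s z≤n))
  ... | ()
  simpleOddClosedWalk⇒cycle {suc (suc (suc k))} _ w ¬rep =
    k , (λ i → vertex w (toℕ i)) , ¬Repeats⇒injective {f = vertex w} ¬rep , steps , lastStep
    where
    steps : ∀ (i : Fin (2 + k)) → adj T (vertex w (toℕ (inject₁ i))) (vertex w (suc (toℕ i))) ≡ true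
    steps i rewrite toℕ-inject₁ i = step w (toℕ i) (<-trans (toℕ<n i) (n<1+n _))
    lastStep : adj T (vertex w (toℕ (fromℕ (2 + k)))) (vertex w 0) ≡ true
    lastStep rewrite toℕ-fromℕ (2 + k) | sym (closed w) = step w (2 + k) ≤-refl

  innerLoop : ∀ {L} (w : ClosedWalk L) i d → i + d < L → vertex w (i + d) ≡ vertex w i → ClosedWalk d
  innerLoop w i d i+d<L repeat = record
    { vertex = λ k → vertex w (i + k)
    ; step   = λ k k<d → subst (λ v → adj T (vertex w (i + k)) (vertex w v) ≡ true) (sym (+-suc i k))
                             (step w (i + k) (<-trans (+-monoʳ-< i k<d) i+d<L))
    ; closed = trans repeat (cong (vertex w) (sym (+-identityʳ i)))
    }

  outerLoop : ∀ {L L′} (w : ClosedWalk L) i d → d + L′ ≡ L → i + d < L → vertex w (i + d) ≡ vertex w i → ClosedWalk L′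
  outerLoop {L′ = L′} w i d refl i+d<L repeat = record { vertex = skip ; step = skip-step ; closed = skip-closed }
    where
    skip : ℕ → Fin n
    skip k with k ≤? i
    ... | yes _ = vertex w k
    ... | no  _ = vertex w (k + d)

    skip-step : ∀ k → k < L′ → adj T (skip k) (skip (suc k)) ≡ true
    skip-step k k<L′ with k ≤? i | suc k ≤? i
    ... | yes _   | yes k<i = step w k (<-trans k<i (≤-<-trans (m≤m+n i d) i+d<L))
    ... | yes k≤i | no  k≮i rewrite ≤-antisym k≤i (s≤s⁻¹ (≰⇒> k≮i)) =
          subst (λ v → adj T v (vertex w (suc i + d)) ≡ true) repeat (step w (i + d) i+d<L)
    ... | no  k≰i | yes k<i = ⊥-elim (k≰i (<⇒≤ k<i))
    ... | no  _   | no  _   = step w (k + d) (subst (_< d + L′) (+-comm d k) (+-monoʳ-< d k<L′))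

    skip-closed : skip L′ ≡ skip 0
    skip-closed with L′ ≤? i | 0 ≤? i
    ... | yes L′≤i | _     = ⊥-elim (<⇒≱ (+-cancelʳ-< d i L′ (subst (i + d <_) (+-comm d L′) i+d<L)) L′≤i)
    ... | no  _    | yes _ = trans (cong (vertex w) (+-comm L′ d)) (closed w)
    ... | no  _    | no 0≰i = ⊥-elim (0≰i z≤n)

  oddClosedWalk⇒cycle : ∀ L → parity L ≡ 1ℙ → ClosedWalk L → HasCycle T
  oddClosedWalk⇒cycle = <-rec (λ L → parity L ≡ 1ℙ → ClosedWalk L → HasCycle T) shortcut
    where
    shortcut : ∀ L → (∀ {L′} → L′ < L → parity L′ ≡ 1ℙ → ClosedWalk L′ → HasCycle T) →
               parity L ≡ 1ℙ → ClosedWalk L → HasCycle T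
    shortcut L shorter odd w with repeats? L (vertex w)
    ... | no ¬rep = simpleOddClosedWalk⇒cycle odd w ¬rep
    ... | yes (i , j , i<j , repeat) =
      [ (λ odd-d → shorter d<L odd-d (innerLoop w (toℕ i) d i+d<L repeat′))
      , (λ odd-L′ → shorter L′<L odd-L′ (outerLoop w (toℕ i) d d+L′≡L i+d<L repeat′))
      ]′ (odd-+⇒odd⊎odd d L′ (subst (λ m → parity m ≡ 1ℙ) (sym d+L′≡L) odd))
      where
      d L′ : ℕ
      d = toℕ j ∸ toℕ i
      L′ = L ∸ d
      i+d≡j : toℕ i + d ≡ toℕ j
      i+d≡j = m+[n∸m]≡n (<⇒≤ i<j)
      i+d<L : toℕ i + d < L
      i+d<L = subst (_< L) (sym i+d≡j) (toℕ<n j)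
      d<L : d < L
      d<L = ≤-<-trans (m≤n+m d (toℕ i)) i+d<L
      d+L′≡L : d + L′ ≡ L
      d+L′≡L = m+[n∸m]≡n (<⇒≤ d<L)
      L′<L : L′ < L
      L′<L = subst (L′ <_) d+L′≡L (m<n+m L′ (m<n⇒0<n∸m i<j))
      repeat′ : vertex w (toℕ i + d) ≡ vertex w (toℕ i)
      repeat′ = trans (cong (vertex w) i+d≡j) (sym repeat)

ProperColouring : ∀ {n} {C : Set} → SGraph n → (Fin n → C) → Set
ProperColouring T colour = ∀ u v → adj T u v ≡ true → colour u ≢ colour v

tree⇒2-colourable : ∀ {n} (T : SGraph n) → IsTree T → Σ (Fin n → Fin 2) (ProperColouring T)
tree⇒2-colourable {zero}  T _                      = (λ ()) , λ ()
tree⇒2-colourable {suc n} T (connected , acyclic) = toFin2 ∘ depthParity , proper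
  where
  depthParity : Fin (suc n) → Parity
  depthParity u = parity (length (connected u fzero))

  toFin2 : Parity → Fin 2
  toFin2 0ℙ = fzero
  toFin2 1ℙ = fsuc fzero

  toFin2-injective : ∀ {p q} → toFin2 p ≡ toFin2 q → p ≡ q
  toFin2-injective {0ℙ} {0ℙ} _ = refl
  toFin2-injective {1ℙ} {1ℙ} _ = refl

  proper : ProperColouring T (toFin2 ∘ depthParity)
  proper u v uv same = acyclic (oddClosedWalk⇒cycle T _ odd (closedWalk T around))
    where
    wu : Walk T u fzero
    wu = connected u fzero
    wv : Walk T v fzero
    wv = connected v fzero
    around : Walk T v v
    around = cons (trans (SGraph.sym T v u) uv) (wu ++ reverse wv)
    odd : parity (length around) ≡ 1ℙ
    odd = begin
      parity (1 + length (wu ++ reverse wv))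
        ≡⟨ cong (λ m → parity (1 + m)) (trans (length-++ wu (reverse wv)) (cong (length wu +_) (length-reverse wv))) ⟩
      parity (1 + (length wu + length wv))
        ≡⟨ trans (+-homo-+ 1 (length wu + length wv)) (cong (1ℙ +ℙ_) (+-homo-+ (length wu) (length wv))) ⟩
      1ℙ +ℙ (depthParity u +ℙ depthParity v)
        ≡⟨ cong (λ p → 1ℙ +ℙ (depthParity u +ℙ p)) (sym (toFin2-injective same)) ⟩
      1ℙ +ℙ (depthParity u +ℙ depthParity u)
        ≡⟨ cong (1ℙ +ℙ_) (p+p≡0ℙ (depthParity u)) ⟩
      1ℙ ∎
      where open ≡-Reasoning

↑ˡ≢↑ʳ : ∀ {m n} (i : Fin m) (j : Fin n) → i ↑ˡ n ≢ m ↑ʳ j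
↑ˡ≢↑ʳ {m} {n} i j eq with trans (sym (splitAt-↑ˡ m i n)) (trans (cong (splitAt m) eq) (splitAt-↑ʳ m n j))
... | ()

offset : ∀ {a} (w : Fin a → ℕ) → Σ (Fin a) (Fin ∘ w) → Fin (sumFin a w)
offset {suc a} w (fzero  , r) = r ↑ˡ sumFin a (w ∘ fsuc)
offset {suc a} w (fsuc i , r) = w fzero ↑ʳ offset (w ∘ fsuc) (i , r)

offset-injective : ∀ {a} (w : Fin a → ℕ) → Injective _≡_ _≡_ (offset w)
offset-injective {suc a} w {fzero  , r} {fzero   , r′} eq = cong (fzero ,_) (↑ˡ-injective _ r r′ eq)
offset-injective {suc a} w {fzero  , r} {fsuc i′ , r′} eq = ⊥-elim (↑ˡ≢↑ʳ r _ eq)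
offset-injective {suc a} w {fsuc i , r} {fzero   , r′} eq = ⊥-elim (↑ˡ≢↑ʳ r′ _ (sym eq))
offset-injective {suc a} w {fsuc i , r} {fsuc i′ , r′} eq =
  cong (λ x → fsuc (proj₁ x) , proj₂ x) (offset-injective (w ∘ fsuc) (↑ʳ-injective (w fzero) _ _ eq))

module _ {n : ℕ} (T : SGraph n) where

  isEdge : Fin n → Fin n → Bool
  isEdge i j = ⌊ i Finₚ.<? j ⌋ ∧ adj T i j

  isEdge-true : ∀ {i j} → i F.< j → adj T i j ≡ true → isEdge i j ≡ true
  isEdge-true {i} {j} i<j ij with i Finₚ.<? j
  ... | yes _    = ij
  ... | no  i≮j = ⊥-elim (i≮j i<j)

  indicator : Bool → ℕ
  indicator b = if b then 1 else 0

  truth : ∀ {b} → b ≡ true → Fin (indicator b)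
  truth refl = fzero

  edgesFrom : Fin n → Fin n → ℕ
  edgesFrom i = indicator ∘ isEdge i

  edgeIndex : Edge T → Fin (edgeCount T)
  edgeIndex ((i , j) , i<j , ij) =
    offset (sumFin n ∘ edgesFrom) (i , offset (edgesFrom i) (j , truth (isEdge-true i<j ij)))

  edge-≡ : ∀ {e e′ : Edge T} → proj₁ e ≡ proj₁ e′ → e ≡ e′
  edge-≡ {_ , i<j , ij} {_ , i<j′ , ij′} refl =
    cong₂ (λ l a → _ , l , a) (Finₚ.<-irrelevant i<j i<j′) (Decidable⇒UIP.≡-irrelevant Bool._≟_ ij ij′)

  edgeIndex-injective : Injective _≡_ _≡_ edgeIndex
  edgeIndex-injective {(i , j) , i<j , ij} {(i′ , j′) , i′<j′ , i′j′} eq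
    with refl , eq′ ← Σ-≡,≡←≡ (offset-injective (sumFin n ∘ edgesFrom) eq)
    with refl , _ ← Σ-≡,≡←≡ (offset-injective (edgesFrom i) eq′)
    = edge-≡ refl

module _ {slots q Tt : ℕ} (room : slots * suc q ≤ Tt) where

  -- Opaque so that uses of the lemmas below recover the implicit slots by unification.
  opaque
    turánVertex : Fin slots → Fin (suc q) → Fin Tt
    turánVertex s c = inject≤ (combine s c) room

  opaque
    unfolding turánVertex

    classOf-turánVertex : ∀ s c → classOf (suc q) (toℕ (turánVertex s c)) ≡ toℕ c
    classOf-turánVertex s c = begin
      toℕ (inject≤ (combine s c) room) % suc q ≡⟨ cong (_% suc q) (trans (toℕ-inject≤ _ room) (toℕ-combine s c)) ⟩
      (suc q * toℕ s + toℕ c) % suc q         ≡⟨ %-remove-+ˡ (toℕ c) (m∣m*n (toℕ s)) ⟩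
      toℕ c % suc q                           ≡⟨ m<n⇒m%n≡m (toℕ<n c) ⟩
      toℕ c                                   ∎
      where open ≡-Reasoning

    turánVertex-injective : ∀ {s s′ c c′} → turánVertex s c ≡ turánVertex s′ c′ → s ≡ s′ × c ≡ c′
    turánVertex-injective eq = combine-injective _ _ _ _ (inject≤-injective room room _ _ eq)

  turánVertex-adjacent : ∀ {s s′ c c′} → c ≢ c′ → Adj (TuranG Tt (suc q)) (turánVertex s c) (turánVertex s′ c′)
  turánVertex-adjacent {s} {s′} {c} {c′} c≢c′ sameClass =
    c≢c′ (toℕ-injective (trans (sym (classOf-turánVertex s c)) (trans sameClass (classOf-turánVertex s′ c′))))

matching⊆matching : ∀ {m ℓ} → m ≤ ℓ → MatchingG m ⊆G MatchingG ℓ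
matching⊆matching {m} {ℓ} room = embed , injective , (λ _ _ (i≡j , a≢b) → cong (λ i → inject≤ i room) i≡j , a≢b)
  where
  embed : Fin m × Fin 2 → Fin ℓ × Fin 2
  embed (i , a) = inject≤ i room , a
  injective : Injective _≡_ _≡_ embed
  injective eq = cong₂ _,_ (inject≤-injective room room _ _ (cong proj₁ eq)) (cong proj₂ eq)

matching⊆path : ∀ {m ℓ} → m * 2 ≤ ℓ → MatchingG m ⊆G PathG ℓ
matching⊆path {m} {ℓ} room = embed , injective , adjacent
  where
  embed : Fin m × Fin 2 → Fin ℓ
  embed (i , a) = inject≤ (combine i a) room

  injective : Injective _≡_ _≡_ embed
  injective eq = uncurry (cong₂ _,_) (combine-injective _ _ _ _ (inject≤-injective room room _ _ eq))

  toℕ-embed : ∀ i a → toℕ (embed (i , a)) ≡ 2 * toℕ i + toℕ a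
  toℕ-embed i a = trans (toℕ-inject≤ _ room) (toℕ-combine i a)

  consecutive : ∀ i → toℕ (embed (i , fsuc fzero)) ≡ suc (toℕ (embed (i , fzero)))
  consecutive i rewrite toℕ-embed i (fsuc fzero) | toℕ-embed i fzero = +-suc (2 * toℕ i) 0

  adjacent : ∀ x y → Adj (MatchingG m) x y → Adj (PathG ℓ) (embed x) (embed y)
  adjacent (i , fzero)      (_ , fzero)      (_ , a≢b)    = ⊥-elim (a≢b refl)
  adjacent (i , fzero)      (_ , fsuc fzero) (refl , _)   = inj₁ (consecutive i)
  adjacent (i , fsuc fzero) (_ , fzero)      (refl , _)   = inj₂ (consecutive i)
  adjacent (i , fsuc fzero) (_ , fsuc fzero) (_ , a≢b)    = ⊥-elim (a≢b refl)

module _ {n : ℕ} (T : SGraph n) {colour : Fin n → Fin 2} (proper : ProperColouring T colour)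
         (k : ℕ) {G : Graph} (matching : MatchingG (edgeCount T) ⊆G G)
         {Tt : ℕ} (room : (n + edgeCount T) * (2 + k) ≤ Tt) where

  private
    m : ℕ
    m = edgeCount T

    Host : Graph
    Host = G ∨G TuranG Tt (2 + k)

    turán : Fin (n + m) → Fin (2 + k) → Fin Tt
    turán = turánVertex room

    matched : Edge T → Fin 2 → V G
    matched e a = proj₁ matching (edgeIndex T e , a)

    matched-injective : ∀ {e e′ a b} → matched e a ≡ matched e′ b → (e , a ↑ˡ k) ≡ (e′ , b ↑ˡ k)
    matched-injective eq with proj₁ (proj₂ matching) eq
    ... | same with edgeIndex-injective T (cong proj₁ same) | cong proj₂ same
    ...   | refl | refl = refl

    matched-adjacent : ∀ {e e′ a b} → proj₁ e ≡ proj₁ e′ → a ≢ b → Adj G (matched e a) (matched e′ b)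
    matched-adjacent same a≢b = proj₂ (proj₂ matching) _ _ (cong (edgeIndex T) (edge-≡ T same) , a≢b)

    embed : V (blowup T (3 + k)) → V Host
    embed (inj₁ u)                   = inj₂ (turán (u ↑ˡ m) (colour u ↑ˡ k))
    embed (inj₂ (e , fzero))         = inj₁ (matched e fzero)
    embed (inj₂ (e , fsuc fzero))    = inj₁ (matched e (fsuc fzero))
    embed (inj₂ (e , fsuc (fsuc c))) = inj₂ (turán (n ↑ʳ edgeIndex T e) (2 ↑ʳ c))

    embed-injective : Injective _≡_ _≡_ embed
    embed-injective {inj₁ u} {inj₁ v} eq =
      cong inj₁ (↑ˡ-injective m u v (proj₁ (turánVertex-injective room (inj₂-injective eq))))
    embed-injective {inj₁ u} {inj₂ (e , fsuc (fsuc c))} eq =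
      ⊥-elim (↑ˡ≢↑ʳ u _ (proj₁ (turánVertex-injective room (inj₂-injective eq))))
    embed-injective {inj₂ (e , fsuc (fsuc c))} {inj₁ u} eq =
      ⊥-elim (↑ˡ≢↑ʳ u _ (sym (proj₁ (turánVertex-injective room (inj₂-injective eq)))))
    embed-injective {inj₂ (e , fzero)}      {inj₂ (e′ , fzero)}      eq = cong inj₂ (matched-injective (inj₁-injective eq))
    embed-injective {inj₂ (e , fzero)}      {inj₂ (e′ , fsuc fzero)} eq = cong inj₂ (matched-injective (inj₁-injective eq))
    embed-injective {inj₂ (e , fsuc fzero)} {inj₂ (e′ , fzero)}      eq = cong inj₂ (matched-injective (inj₁-injective eq))
    embed-injective {inj₂ (e , fsuc fzero)} {inj₂ (e′ , fsuc fzero)} eq = cong inj₂ (matched-injective (inj₁-injective eq))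
    embed-injective {inj₂ (e , fsuc (fsuc c))} {inj₂ (e′ , fsuc (fsuc c′))} eq
      with turánVertex-injective room (inj₂-injective eq)
    ... | sameSlot , sameClass with edgeIndex-injective T {e} {e′} (↑ʳ-injective n _ _ sameSlot) | ↑ʳ-injective 2 c c′ sameClass
    ...   | refl | refl = refl
    embed-injective {inj₁ _}                {inj₂ (_ , fzero)}          ()
    embed-injective {inj₁ _}                {inj₂ (_ , fsuc fzero)}     ()
    embed-injective {inj₂ (_ , fzero)}      {inj₁ _}                    ()
    embed-injective {inj₂ (_ , fsuc fzero)} {inj₁ _}                    ()
    embed-injective {inj₂ (_ , fzero)}      {inj₂ (_ , fsuc (fsuc _))} ()
    embed-injective {inj₂ (_ , fsuc fzero)} {inj₂ (_ , fsuc (fsuc _))} ()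
    embed-injective {inj₂ (_ , fsuc (fsuc _))} {inj₂ (_ , fzero)}      ()
    embed-injective {inj₂ (_ , fsuc (fsuc _))} {inj₂ (_ , fsuc fzero)} ()

    embed-adjacent : ∀ x y → Adj (blowup T (3 + k)) x y → Adj Host (embed x) (embed y)
    embed-adjacent (inj₁ u) (inj₁ v) uv = turánVertex-adjacent room (proper u v uv ∘ ↑ˡ-injective k _ _)
    embed-adjacent (inj₁ u) (inj₂ (e , fzero))         _ = tt
    embed-adjacent (inj₁ u) (inj₂ (e , fsuc fzero))    _ = tt
    embed-adjacent (inj₁ u) (inj₂ (e , fsuc (fsuc c))) _ = turánVertex-adjacent room (↑ˡ≢↑ʳ (colour u) c)
    embed-adjacent (inj₂ (e , fzero))         (inj₁ u) _ = tt
    embed-adjacent (inj₂ (e , fsuc fzero))    (inj₁ u) _ = tt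
    embed-adjacent (inj₂ (e , fsuc (fsuc c))) (inj₁ u) _ = turánVertex-adjacent room (↑ˡ≢↑ʳ (colour u) c ∘ sym)
    embed-adjacent (inj₂ (e , fzero))      (inj₂ (e′ , fzero))      (_ , a≢b)  = ⊥-elim (a≢b refl)
    embed-adjacent (inj₂ (e , fzero))      (inj₂ (e′ , fsuc fzero)) (same , _) = matched-adjacent same λ ()
    embed-adjacent (inj₂ (e , fsuc fzero)) (inj₂ (e′ , fzero))      (same , _) = matched-adjacent same λ ()
    embed-adjacent (inj₂ (e , fsuc fzero)) (inj₂ (e′ , fsuc fzero)) (_ , a≢b)  = ⊥-elim (a≢b refl)
    embed-adjacent (inj₂ (e , fzero))         (inj₂ (e′ , fsuc (fsuc c))) _ = tt
    embed-adjacent (inj₂ (e , fsuc fzero))    (inj₂ (e′ , fsuc (fsuc c))) _ = tt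
    embed-adjacent (inj₂ (e , fsuc (fsuc c))) (inj₂ (e′ , fzero))         _ = tt
    embed-adjacent (inj₂ (e , fsuc (fsuc c))) (inj₂ (e′ , fsuc fzero))    _ = tt
    embed-adjacent (inj₂ (e , fsuc (fsuc c))) (inj₂ (e′ , fsuc (fsuc c′))) (_ , c≢c′) = turánVertex-adjacent room c≢c′

  blowup⊆join : blowup T (3 + k) ⊆G (G ∨G TuranG Tt (2 + k))
  blowup⊆join = embed , embed-injective , embed-adjacent

lemma2p3 : ∀ {n} (T : SGraph n) → IsTree T → (p : ℕ) → 3 ≤ p →
    (blowup T p ⊆G (PathG (blowupSize T p) ∨G TuranG ((p ∸ 1) * blowupSize T p) (p ∸ 1)))
    × (blowup T p ⊆G (MatchingG (blowupSize T p) ∨G TuranG (2 * (p ∸ 1) * blowupSize T p) (p ∸ 1)))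
lemma2p3 {n} T tree (suc (suc (suc k))) _ =
    blowup⊆join T proper k (matching⊆path m*2≤ℓ) slots*q≤q*ℓ
  , blowup⊆join T proper k (matching⊆matching m≤ℓ) (≤-trans slots*q≤q*ℓ (*-monoˡ-≤ ℓ (m≤n*m q 2)))
  where
  q m ℓ : ℕ
  q = suc (suc k)
  m = edgeCount T
  ℓ = blowupSize T (suc q)
  proper : ProperColouring T (proj₁ (tree⇒2-colourable T tree))
  proper = proj₂ (tree⇒2-colourable T tree)
  qm≤ℓ : q * m ≤ ℓ
  qm≤ℓ = m≤n+m (q * m) n
  m*2≤ℓ : m * 2 ≤ ℓ
  m*2≤ℓ = ≤-trans (*-monoʳ-≤ m (s≤s (s≤s z≤n))) (≤-trans (≤-reflexive (*-comm m q)) qm≤ℓ)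
  m≤ℓ : m ≤ ℓ
  m≤ℓ = ≤-trans (m≤n*m m q) qm≤ℓ
  slots*q≤q*ℓ : (n + m) * q ≤ q * ℓ
  slots*q≤q*ℓ = ≤-trans (≤-reflexive (*-comm (n + m) q)) (*-monoʳ-≤ q (+-monoʳ-≤ n (m≤n*m m q)))
lemma2p3 T tree 0 ()
lemma2p3 T tree 1 (s≤s ())
lemma2p3 T tree 2 (s≤s (s≤s ()))
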